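{- Let $k \ge 3$ and let $\Phi$ be an E3-SAT formula with $m$ clauses and $n$ variables; let $G_\Phi$, $I_s$, $I_t$ be as in the context. Suppose a shortest reconfiguration sequence from $I_s$ to $I_t$ in $G_\Phi$ under the $k$-Jump model has length at most $2(m+n)$. Then in such a shortest reconfiguration sequence, tracking tokens as in the context: (S1) for every $0 \le i \le m-1$, the token initially on $v^i_0$ moves exactly twice, and for every $0 \le j \le n-1$, the tokens initially on $s^j_0$ and on $s^j_1$ each move exactly once; (S2) for every $0 \le i \le m-1$, the token initially on $v^i_0$ is on $v^i_{2k}$ at the end; (S3) for every $0 \le j \le n-1$, the tokens initially on $s^j_0$ and $s^j_1$ are each on $t^j_0$ or $t^j_1$ at the end.
   Context: Fix an integer $k \ge 3$. An E3-SAT formula is a CNF formula in which every clause has exactly three literals. Let $\Phi$ have clauses $c_0, \dots, c_{m-1}$ and variables $x_0, \dots, x_{n-1}$. The graph $G_\Phi$: for each clause $c_i$, a path $v^i_0 v^i_1 \cdots v^i_{2k}$, with $k^i_1 = v^i_k$, plus vertices $k^i_0, k^i_2$ each adjacent to $v^i_{k-1}$ and $v^i_{k+1}$; for each variable $x_j$, a path $u^j_0 \cdots u^j_{k-1}$ with $t^j_0 = u^j_0$, $t^j_1 = u^j_{k-1}$, plus vertices $s^j_0, s^j_1$ each adjacent to $t^j_0$; the set $K = \{k^i_0, k^i_1, k^i_2 : 0 \le i < m\}$ is a clique; for each clause $c_i = (\ell_0 \vee \ell_1 \vee \ell_2)$ and $r \in \{0,1,2\}$, with $x_j$ the variable of $\ell_r$,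 add edges $\{s^j_0, k^i_r\}, \{t^j_0, k^i_r\}$ if $\ell_r$ is positive and $\{s^j_1, k^i_r\}, \{t^j_0, k^i_r\}$ if $\ell_r$ is negative; no other edges. $I_s = \{v^i_0 : 0 \le i < m\} \cup \{s^j_0, s^j_1 : 0 \le j < n\}$ and $I_t = \{v^i_{2k} : 0 \le i < m\} \cup \{t^j_0, t^j_1 : 0 \le j < n\}$. For independent sets $I, J$, write $I \leftrightarrow_k J$ if $|I \setminus J| = |J \setminus I| = 1$ and $\mathrm{dist}_{G_\Phi}(u,v) \le k$ where $I \setminus J = \{u\}$, $J \setminus I = \{v\}$; such a step is interpreted as the token on $u$ moving to $v$ (every other token stays). A reconfiguration sequence of length $\ell$ from $I_s$ to $I_t$ is a sequence $I_s = I_0, \dots, I_\ell = I_t$ of independent sets with $I_j \leftrightarrow_k I_{j+1}$ for all $j$; tokens are placed on the vertices of $I_s$ initially and followed through the moves. -}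

module Defs where

open import Data.Nat using (ℕ; zero; suc; _*_; _≤_; _∸_; _≡ᵇ_)
open import Data.Fin using (Fin; toℕ)
open import Data.Bool using (Bool; true; false; _∨_)
open import Data.Product using (Σ; ∃; ∃-syntax; _×_; _,_)
open import Data.Sum using (_⊎_)
open import Relation.Binary.PropositionalEquality using (_≡_; _≢_)
open import Relation.Nullary using (¬_)

record Literal (n : ℕ) : Set where
  constructor lit
  field
    var      : Fin n
    positive : Bool    -- true: x_j ; false: ¬ x_j

-- clause c_i = (ℓ_0 ∨ ℓ_1 ∨ ℓ_2) is  Φ i : Fin 3 → Literal n
Formula : ℕ → ℕ → Set
Formula m n = Fin m → Fin 3 → Literal n

IsE3 : ∀ {m n} → Formula m n → Set
IsE3 {m} Φ = ∀ (i : Fin m) (r r' : Fin 3) → Φ i r ≡ Φ i r' → r ≡ r'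

module G (k m n : ℕ) (Φ : Formula m n) where

  data Vertex : Set where
    pv : Fin m → Fin (suc (2 * k)) → Vertex   -- pv i a = v^i_a   (so k^i_1 = v^i_k)
    ka : Fin m → Vertex
    kb : Fin m → Vertex
    pu : Fin n → Fin k → Vertex              -- pu j b = u^j_b  (t^j_0 = u^j_0, t^j_1 = u^j_{k-1})
    ps : Fin n → Fin 2 → Vertex

  sIdx : Literal n → Fin 2
  sIdx l with Literal.positive l
  ... | true  = Fin.zero
  ... | false = Fin.suc Fin.zero

  data KVert (i : Fin m) : Fin 3 → Vertex → Set where
    k0 : KVert i Fin.zero (ka i)
    k1 : ∀ (a : Fin (suc (2 * k))) → toℕ a ≡ k → KVert i (Fin.suc Fin.zero) (pv i a)
    k2 : KVert i (Fin.suc (Fin.suc Fin.zero)) (kb i)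

  InK : Vertex → Set
  InK x = ∃[ i ] ∃[ r ] KVert i r x

  -- the (undirected) edges, listed in one orientation
  data Edge : Vertex → Vertex → Set where
    v-path  : ∀ i (a b : Fin (suc (2 * k))) → toℕ b ≡ suc (toℕ a) → Edge (pv i a) (pv i b)
    ka-left : ∀ i (a : Fin (suc (2 * k))) → suc (toℕ a) ≡ k → Edge (ka i) (pv i a)
    ka-right : ∀ i (a : Fin (suc (2 * k))) → toℕ a ≡ suc k → Edge (ka i) (pv i a)
    kb-left : ∀ i (a : Fin (suc (2 * k))) → suc (toℕ a) ≡ k → Edge (kb i) (pv i a)
    kb-right : ∀ i (a : Fin (suc (2 * k))) → toℕ a ≡ suc k → Edge (kb i) (pv i a)
    u-path  : ∀ j (a b : Fin k) → toℕ b ≡ suc (toℕ a) → Edge (pu j a) (pu j b)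
    s-t0    : ∀ j e (z : Fin k) → toℕ z ≡ 0 → Edge (ps j e) (pu j z)
    clique  : ∀ x y → InK x → InK y → x ≢ y → Edge x y
    lit-s   : ∀ i r x → KVert i r x →
              Edge (ps (Literal.var (Φ i r)) (sIdx (Φ i r))) x
    lit-t   : ∀ i r x (z : Fin k) → KVert i r x → toℕ z ≡ 0 →
              Edge (pu (Literal.var (Φ i r)) z) x

  Adj : Vertex → Vertex → Set
  Adj x y = Edge x y ⊎ Edge y x

  data Walk : ℕ → Vertex → Vertex → Set where
    here : ∀ x → Walk 0 x x
    step : ∀ {ℓ x y z} → Adj x y → Walk ℓ y z → Walk (suc ℓ) x z

  DistLe : ℕ → Vertex → Vertex → Set
  DistLe d x y = ∃[ ℓ ] (ℓ ≤ d × Walk ℓ x y)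

  VSet : Set
  VSet = Vertex → Bool

  Independent : VSet → Set
  Independent I = ∀ x y → I x ≡ true → I y ≡ true → ¬ Adj x y

  I-s : VSet
  I-s (pv i a) = toℕ a ≡ᵇ 0
  I-s (ka i)   = false
  I-s (kb i)   = false
  I-s (pu j b) = false
  I-s (ps j e) = true

  I-t : VSet
  I-t (pv i a) = toℕ a ≡ᵇ 2 * k
  I-t (ka i)   = false
  I-t (kb i)   = false
  I-t (pu j b) = (toℕ b ≡ᵇ 0) ∨ (toℕ b ≡ᵇ k ∸ 1)
  I-t (ps j e) = false

  -- For each step t < len, 'from t' and 'to t' are the
  -- (unique) vertices with I_t ∖ I_{t+1} = {from t}, I_{t+1} ∖ I_t = {to t}.
  record ReconfSeq : Set where
    field
      len   : ℕ
      sets  : ℕ → VSet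
      from  : ℕ → Vertex
      to    : ℕ → Vertex
      indep : ∀ t → t ≤ len → Independent (sets t)
      start : ∀ x → sets 0 x ≡ I-s x
      end   : ∀ x → sets len x ≡ I-t x
      from-out  : ∀ t → suc t ≤ len → sets t (from t) ≡ true × sets (suc t) (from t) ≡ false
      from-uniq : ∀ t → suc t ≤ len → ∀ w → sets t w ≡ true → sets (suc t) w ≡ false → w ≡ from t
      to-in     : ∀ t → suc t ≤ len → sets t (to t) ≡ false × sets (suc t) (to t) ≡ true
      to-uniq   : ∀ t → suc t ≤ len → ∀ w → sets t w ≡ false → sets (suc t) w ≡ true → w ≡ to t
      jump      : ∀ t → suc t ≤ len → DistLe k (from t) (to t)

  open ReconfSeq

  Shortest : ReconfSeq → Set
  Shortest S = ∀ (S' : ReconfSeq) → len S ≤ len S'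

  -- Track S x t y c : the token placed on x in I_s is on y in I_t and has moved c times
  -- during the first t steps.
  data Track (S : ReconfSeq) (x : Vertex) : ℕ → Vertex → ℕ → Set where
    begin : Track S x 0 x 0
    stay  : ∀ {t y c} → Track S x t y c → y ≢ from S t → Track S x (suc t) y c
    move  : ∀ {t y c} → Track S x t y c → y ≡ from S t → Track S x (suc t) (to S t) (suc c)

  TokenEnd : ReconfSeq → Vertex → (Vertex → ℕ → Set) → Set
  TokenEnd S x P = (∃[ y ] ∃[ c ] Track S x (len S) y c)
                 × (∀ y c → Track S x (len S) y c → P y c)

  IsTj : Fin n → Vertex → Set
  IsTj j y = ∃[ z ] (y ≡ pu j z × (toℕ z ≡ 0 ⊎ toℕ z ≡ k ∸ 1))

{-# OPTIONS --safe #-}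
-- Follow every token of I_s through the sequence. A move jumps distance at most k, so a potential that
-- changes by at most 1 along edges grows by at most k per move. Every vertex of I_t lies more than k
-- away from v^i_0, and s^j_e ∉ I_t, so the token of v^i_0 moves at least twice and that of s^j_e at
-- least once. Only one token moves per step, so length ≤ 2(m + n) makes all these bounds exact.
-- The vertex v^i_{2k} is occupied at the end, and no token other than that of v^i_0 gets close enough
-- to it. The token of s^j_e ends within distance k of s^j_e, hence on t^j_0, t^j_1 or some t^{j'}_0.
-- Suppose step t is the first to put a token on a foreign t^{j'}_0. Both tokens of s^{j'}, adjacent to
-- t^{j'}_0, have made their only move before t; being neither on a foreign t_0 nor on the then free
-- t^{j'}_0, both sit on t^{j'}_1, which is impossible.
module Submission where

open import Data.Bool using (Bool; true; false; not; if_then_else_; T)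
open import Data.Bool.Properties using (T-∨; T-≡)
open import Data.Empty using (⊥; ⊥-elim)
open import Data.Fin using (Fin; zero; suc; toℕ; fromℕ; splitAt; join; _↑ˡ_; _↑ʳ_)
import Data.Fin.Properties as Finₚ
open import Data.Nat
  using (ℕ; zero; suc; _+_; _*_; _∸_; _≤_; _<_; _≤′_; ≤′-refl; ≤′-step; z≤n; s≤s; ∣_-_∣)
open import Data.Nat.Properties
open import Algebra.Properties.CommutativeMonoid.Sum +-0-commutativeMonoid
  using (sum; sum-syntax; sum-cong-≗; sum-replicate-zero; ∑-distrib-+)
open import Data.Nat.Tactic.RingSolver using (solve-∀)
open import Data.Product using (_×_; _,_; proj₁; proj₂; ∃-syntax)
open import Data.Sum using (_⊎_; inj₁; inj₂; [_,_])
import Data.Sum as Sum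
open import Data.Sum.Properties using ([,]-map)
open import Data.Vec.Functional using (Vector; _++_)
open import Data.Vec.Functional.Properties using (lookup-++ˡ; lookup-++ʳ)
open import Function using (_∘_; Injective; Equivalence)
open import Relation.Binary.PropositionalEquality
  using (_≡_; _≢_; refl; sym; trans; cong; cong₂; subst; subst₂; module ≡-Reasoning)
open import Relation.Nullary using (¬_; does; yes; no)
open import Relation.Nullary.Decidable using (dec-true)

open import Defs

∑-const : ∀ N c → ∑[ p < N ] c ≡ N * c
∑-const zero    c = refl
∑-const (suc N) c = cong (c +_) (∑-const N c)

∑-mono-≤ : ∀ {N} {f g : Vector ℕ N} → (∀ p → f p ≤ g p) → sum f ≤ sum g
∑-mono-≤ {zero}  f≤g = z≤n
∑-mono-≤ {suc N} f≤g = +-mono-≤ (f≤g zero) (∑-mono-≤ (f≤g ∘ suc))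

∑-tight : ∀ {N} {f g : Vector ℕ N} → (∀ p → f p ≤ g p) → sum g ≤ sum f → ∀ p → f p ≡ g p
∑-tight {suc N} {f} {g} f≤g ∑g≤∑f = λ where
    zero    → ≤-antisym (f≤g zero) g₀≤f₀
    (suc p) → ∑-tight (f≤g ∘ suc) ∑g'≤∑f' p
  where
  g₀≤f₀ : g zero ≤ f zero
  g₀≤f₀ = +-cancelʳ-≤ _ _ _ (≤-trans ∑g≤∑f (+-monoʳ-≤ (f zero) (∑-mono-≤ (f≤g ∘ suc))))
  ∑g'≤∑f' : sum (g ∘ suc) ≤ sum (f ∘ suc)
  ∑g'≤∑f' = +-cancelˡ-≤ (g zero) _ _ (≤-trans ∑g≤∑f (+-monoˡ-≤ _ (f≤g zero)))

∑-indicator-≤1 : ∀ {N} (b : Vector Bool N) → (∀ {p q} → b p ≡ true → b q ≡ true → p ≡ q) →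
                 ∑[ p < N ] (if b p then 1 else 0) ≤ 1
∑-indicator-≤1 {zero}  b unique = z≤n
∑-indicator-≤1 {suc N} b unique with b zero in b₀
... | false = ∑-indicator-≤1 (b ∘ suc) (λ bp bq → Finₚ.suc-injective (unique bp bq))
... | true  = s≤s (≤-reflexive (trans (sum-cong-≗ rest-false) (sum-replicate-zero N)))
  where
  rest-false : ∀ p → (if b (suc p) then 1 else 0) ≡ 0
  rest-false p with b (suc p) in bp
  ... | false = refl
  ... | true  with () ← unique b₀ bp

∑-++ : ∀ {A : Set} {m n} (f : A → ℕ) (xs : Vector A m) (ys : Vector A n) →
       ∑[ p < m + n ] f ((xs ++ ys) p) ≡ ∑[ i < m ] f (xs i) + ∑[ j < n ] f (ys j)
∑-++ {m = zero}  f xs ys = refl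
∑-++ {m = suc m} f xs ys = begin
  f (xs zero) + ∑[ p < m + _ ] f ((xs ++ ys) (suc p))
    ≡⟨ cong (f (xs zero) +_) (sum-cong-≗ (λ p → cong f ([,]-map (splitAt m p)))) ⟩
  f (xs zero) + ∑[ p < m + _ ] f ((xs ∘ suc ++ ys) p)
    ≡⟨ cong (f (xs zero) +_) (∑-++ f (xs ∘ suc) ys) ⟩
  f (xs zero) + (∑[ i < m ] f (xs (suc i)) + ∑[ j < _ ] f (ys j))
    ≡⟨ +-assoc (f (xs zero)) _ _ ⟨
  f (xs zero) + ∑[ i < m ] f (xs (suc i)) + ∑[ j < _ ] f (ys j) ∎
  where open ≡-Reasoning

++-injective : ∀ {A : Set} {m n} (xs : Vector A m) (ys : Vector A n) →
               Injective _≡_ _≡_ xs → Injective _≡_ _≡_ ys → (∀ i j → xs i ≢ ys j) →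
               Injective _≡_ _≡_ (xs ++ ys)
++-injective {m = m} {n} xs ys xs-inj ys-inj disjoint {p} {q} eq =
  trans (sym (Finₚ.join-splitAt m n p))
        (trans (cong (join m n) (split-inj (splitAt m p) (splitAt m q) eq)) (Finₚ.join-splitAt m n q))
  where
  split-inj : ∀ u v → [ xs , ys ] u ≡ [ xs , ys ] v → u ≡ v
  split-inj (inj₁ i) (inj₁ j) e = cong inj₁ (xs-inj e)
  split-inj (inj₁ i) (inj₂ j) e = ⊥-elim (disjoint i j e)
  split-inj (inj₂ i) (inj₁ j) e = ⊥-elim (disjoint j i (sym e))
  split-inj (inj₂ i) (inj₂ j) e = cong inj₂ (ys-inj e)

Close : ℕ → ℕ → Set
Close a b = a ≤ suc b × b ≤ suc a

close-refl : ∀ a → Close a a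
close-refl a = n≤1+n a , n≤1+n a

close-suc : ∀ a → Close a (suc a)
close-suc a = m≤n⇒m≤1+n (n≤1+n a) , ≤-refl

close-sym : ∀ {a b} → Close a b → Close b a
close-sym (a≤ , b≤) = b≤ , a≤

close-+ : ∀ c {a b} → Close a b → Close (c + a) (c + b)
close-+ c (a≤ , b≤) = ≤-trans (+-monoʳ-≤ c a≤) (≤-reflexive (+-suc c _))
                    , ≤-trans (+-monoʳ-≤ c b≤) (≤-reflexive (+-suc c _))

close-∣-∣ : ∀ a c → Close ∣ a - c ∣ ∣ suc a - c ∣
close-∣-∣ zero    zero    = close-suc 0
close-∣-∣ zero    (suc c) = close-sym (close-suc c)
close-∣-∣ (suc a) zero    = close-suc (suc a)
close-∣-∣ (suc a) (suc c) = close-∣-∣ a c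

close-between : ∀ c {a b} → c ≤ a × a ≤ suc c → c ≤ b × b ≤ suc c → Close a b
close-between c (c≤a , a≤) (c≤b , b≤) = ≤-trans a≤ (s≤s c≤b) , ≤-trans b≤ (s≤s c≤a)

1+n≤c*n⇒2≤c : ∀ {c d} → suc d ≤ c * d → 2 ≤ c
1+n≤c*n⇒2≤c {zero}        ()
1+n≤c*n⇒2≤c {suc zero}    {d} le = ⊥-elim (1+n≰n (≤-trans le (≤-reflexive (+-identityʳ d))))
1+n≤c*n⇒2≤c {suc (suc c)} _  = s≤s (s≤s z≤n)

2+[n∸1]≰n : ∀ c → ¬ (2 + (c ∸ 1) ≤ c)
2+[n∸1]≰n zero    ()
2+[n∸1]≰n (suc c) (s≤s le) = 1+n≰n le

module _ {k m n : ℕ} {Φ : Formula m n} where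
  open G k m n Φ renaming (begin to track₀)

  Lipschitz : (Vertex → ℕ) → Set
  Lipschitz f = ∀ {x y} → Edge x y → Close (f x) (f y)

  lipschitz-walk : ∀ {f ℓ x y} → Lipschitz f → Walk ℓ x y → f y ≤ f x + ℓ
  lipschitz-walk f-lip (here x) = m≤m+n _ 0
  lipschitz-walk {f} f-lip (step {ℓ} {x} x~y walk) = begin
    f _            ≤⟨ lipschitz-walk f-lip walk ⟩
    f _ + ℓ        ≤⟨ +-monoˡ-≤ ℓ (adjacent x~y) ⟩
    suc (f x) + ℓ  ≡⟨ +-suc (f x) ℓ ⟨
    f x + suc ℓ    ∎
    where
    open ≤-Reasoning
    adjacent : ∀ {x y} → Adj x y → f y ≤ suc (f x)
    adjacent (inj₁ e) = proj₂ (f-lip e)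
    adjacent (inj₂ e) = proj₁ (f-lip e)

  lipschitz-dist : ∀ {f d x y} → Lipschitz f → DistLe d x y → f y ≤ f x + d
  lipschitz-dist {f} {x = x} f-lip (ℓ , ℓ≤d , walk) =
    ≤-trans (lipschitz-walk f-lip walk) (+-monoʳ-≤ (f x) ℓ≤d)

  walk-++ : ∀ {a b x y z} → Walk a x y → Walk b y z → Walk (a + b) x z
  walk-++ (here _)        w = w
  walk-++ (step x~y walk) w = step x~y (walk-++ walk w)

  dist-trans : ∀ {a b x y z} → DistLe a x y → DistLe b y z → DistLe (a + b) x z
  dist-trans (ℓ , ℓ≤a , v) (ℓ' , ℓ'≤b , w) = ℓ + ℓ' , +-mono-≤ ℓ≤a ℓ'≤b , walk-++ v w

  record Profile : Set where
    field
      onPath : Fin m → ℕ → ℕ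
      onU    : Fin n → Fin k → ℕ
      onS    : Fin n → Fin 2 → ℕ

  open Profile

  potential : Profile → Vertex → ℕ
  potential P (pv i a) = onPath P i (toℕ a)
  potential P (ka i)   = onPath P i k
  potential P (kb i)   = onPath P i k
  potential P (pu j b) = onU P j b
  potential P (ps j e) = onS P j e

  potential-K : ∀ P {i r x} → KVert i r x → potential P x ≡ onPath P i k
  potential-K P k0           = refl
  potential-K P (k1 a a≡k)   = cong (onPath P _) a≡k
  potential-K P k2           = refl

  record LipschitzProfile (P : Profile) : Set where
    field
      path-step : ∀ i c → Close (onPath P i c) (onPath P i (suc c))
      u-step    : ∀ j (b b' : Fin k) → toℕ b' ≡ suc (toℕ b) → Close (onU P j b) (onU P j b')
      s-t₀      : ∀ j e (z : Fin k) → toℕ z ≡ 0 → Close (onS P j e) (onU P j z)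
      K-K       : ∀ i i' → Close (onPath P i k) (onPath P i' k)
      s-K       : ∀ i r → Close (onS P (Literal.var (Φ i r)) (sIdx (Φ i r))) (onPath P i k)
      t₀-K      : ∀ i r (z : Fin k) → toℕ z ≡ 0 → Close (onU P (Literal.var (Φ i r)) z) (onPath P i k)

  potential-lipschitz : ∀ {P} → LipschitzProfile P → Lipschitz (potential P)
  potential-lipschitz {P} L = λ where
      (v-path i a b b≡a+1)    → path-edge i b≡a+1
      (ka-left i a a+1≡k)     → close-sym (path-edge i (sym a+1≡k))
      (ka-right i a a≡k+1)    → path-edge i a≡k+1
      (kb-left i a a+1≡k)     → close-sym (path-edge i (sym a+1≡k))
      (kb-right i a a≡k+1)    → path-edge i a≡k+1
      (u-path j b b' b'≡b+1)  → u-step j b b' b'≡b+1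
      (s-t0 j e z z≡0)        → s-t₀ j e z z≡0
      (clique x y (i , _ , x∈K) (i' , _ , y∈K) _) →
        subst₂ Close (sym (potential-K P x∈K)) (sym (potential-K P y∈K)) (K-K i i')
      (lit-s i r x x∈K)       → subst (Close _) (sym (potential-K P x∈K)) (s-K i r)
      (lit-t i r x z x∈K z≡0) → subst (Close _) (sym (potential-K P x∈K)) (t₀-K i r z z≡0)
    where
    open LipschitzProfile L
    path-edge : ∀ i {a c} → c ≡ suc a → Close (onPath P i a) (onPath P i c)
    path-edge i {a} c≡a+1 = subst (Close _ ∘ onPath P i) (sym c≡a+1) (path-step i a)

  -- Lower bound on the distance from v^i_0: leaving path i costs k + 1 steps, plus ∣ c - k ∣ to
  -- reach position c of another clause path.
  fromClause : Fin m → Profile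
  fromClause i = record
    { onPath = λ i' c → if does (i' Finₚ.≟ i) then c else suc k + ∣ c - k ∣
    ; onU    = λ _ _ → suc k
    ; onS    = λ _ _ → suc k
    }

  -- Lower bound on the distance from s^j_e: one step to K or to u^j_0, and one more into the gadget
  -- of any other variable.
  fromVariable : Fin n → Profile
  fromVariable j = record
    { onPath = λ _ c → suc ∣ c - k ∣
    ; onU    = λ j' b → if does (j' Finₚ.≟ j) then suc (toℕ b) else 2 + toℕ b
    ; onS    = λ j' _ → if does (j' Finₚ.≟ j) then 0 else 2
    }

  fromClause-lipschitz : ∀ i → LipschitzProfile (fromClause i)
  fromClause-lipschitz i = record
    { path-step = path-step
    ; u-step    = λ _ _ _ _ → close-refl (suc k)
    ; s-t₀      = λ _ _ _ _ → close-refl (suc k)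
    ; K-K       = λ i₁ i₂ → close-between k (K-range i₁) (K-range i₂)
    ; s-K       = λ i' _ → close-between k (n≤1+n k , ≤-refl) (K-range i')
    ; t₀-K      = λ i' _ _ _ → close-between k (n≤1+n k , ≤-refl) (K-range i')
    }
    where
    P : Profile
    P = fromClause i
    path-step : ∀ i' c → Close (onPath P i' c) (onPath P i' (suc c))
    path-step i' c with i' Finₚ.≟ i
    ... | yes _ = close-suc c
    ... | no  _ = close-+ (suc k) (close-∣-∣ c k)
    K-range : ∀ i' → k ≤ onPath P i' k × onPath P i' k ≤ suc k
    K-range i' with i' Finₚ.≟ i
    ... | yes _ = ≤-refl , n≤1+n k
    ... | no  _ = ≤-trans (n≤1+n k) (m≤m+n _ _)
                , ≤-reflexive (trans (cong (suc k +_) (∣n-n∣≡0 k)) (+-identityʳ (suc k)))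

  fromVariable-lipschitz : ∀ j → LipschitzProfile (fromVariable j)
  fromVariable-lipschitz j = record
    { path-step = λ _ c → close-+ 1 (close-∣-∣ c k)
    ; u-step    = u-step
    ; s-t₀      = s-t₀
    ; K-K       = λ _ _ → close-refl _
    ; s-K       = λ i r → subst (Close _) (sym K-value) (s-one (Literal.var (Φ i r)) (sIdx (Φ i r)))
    ; t₀-K      = λ i r z z≡0 → subst (Close _) (sym K-value) (t₀-one (Literal.var (Φ i r)) z z≡0)
    }
    where
    P : Profile
    P = fromVariable j
    K-value : suc ∣ k - k ∣ ≡ 1
    K-value = cong suc (∣n-n∣≡0 k)
    u-step : ∀ j' (b b' : Fin k) → toℕ b' ≡ suc (toℕ b) → Close (onU P j' b) (onU P j' b')
    u-step j' b b' b'≡b+1 rewrite b'≡b+1 with j' Finₚ.≟ j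
    ... | yes _ = close-suc _
    ... | no  _ = close-suc _
    s-t₀ : ∀ j' e (z : Fin k) → toℕ z ≡ 0 → Close (onS P j' e) (onU P j' z)
    s-t₀ j' e z z≡0 rewrite z≡0 with j' Finₚ.≟ j
    ... | yes _ = close-suc 0
    ... | no  _ = close-refl 2
    s-one : ∀ j' e → Close (onS P j' e) 1
    s-one j' e with j' Finₚ.≟ j
    ... | yes _ = close-suc 0
    ... | no  _ = close-sym (close-suc 1)
    t₀-one : ∀ j' (z : Fin k) → toℕ z ≡ 0 → Close (onU P j' z) 1
    t₀-one j' z z≡0 rewrite z≡0 with j' Finₚ.≟ j
    ... | yes _ = close-refl 1
    ... | no  _ = close-sym (close-suc 1)

  data Initial : Vertex → Set where
    clause-start   : ∀ i → Initial (pv i zero)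
    variable-start : ∀ j e → Initial (ps j e)

  initial : ∀ {x} → I-s x ≡ true → Initial x
  initial {pv i zero}    _ = clause-start i
  initial {ps j e}       _ = variable-start j e
  initial {pv _ (suc _)} ()
  initial {ka _}         ()
  initial {kb _}         ()
  initial {pu _ _}       ()

  data Target : Vertex → Set where
    clause-end : ∀ i → Target (pv i (fromℕ (2 * k)))
    terminal   : ∀ {y} j → IsTj j y → Target y

  target : ∀ {y} → I-t y ≡ true → Target y
  target {pv i a} h = subst (Target ∘ pv i) (sym a≡2k) (clause-end i)
    where
    a≡2k : a ≡ fromℕ (2 * k)
    a≡2k = Finₚ.toℕ-injective (trans (≡ᵇ⇒≡ _ _ (subst T (sym h) _)) (sym (Finₚ.toℕ-fromℕ _)))
  target {pu j b} h =
    terminal j (b , refl , Sum.map (≡ᵇ⇒≡ _ _) (≡ᵇ⇒≡ _ _) (Equivalence.to T-∨ (subst T (sym h) _)))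
  target {ka _}   ()
  target {kb _}   ()
  target {ps _ _} ()

  Foreign : Fin n → Vertex → Set
  Foreign j y = ∃[ j' ] ∃[ z ] (j' ≢ j × y ≡ pu j' z × toℕ z ≡ 0)

  ∣2k-k∣≡k : ∣ 2 * k - k ∣ ≡ k
  ∣2k-k∣≡k = trans (∣-∣-comm (2 * k) k) (trans (∣m-m+n∣≡n k (k + 0)) (+-identityʳ k))

  fromClause-start : ∀ i → potential (fromClause i) (pv i zero) ≡ 0
  fromClause-start i rewrite dec-true (i Finₚ.≟ i) refl = refl

  fromClause-target : 0 < k → ∀ i {y} → Target y → suc k ≤ potential (fromClause i) y
  fromClause-target 0<k i (clause-end i') with i' Finₚ.≟ i
  ... | yes _ rewrite Finₚ.toℕ-fromℕ (2 * k) =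
        ≤-trans (≤-reflexive (+-comm 1 k)) (+-monoʳ-≤ k (≤-trans 0<k (m≤m+n k 0)))
  ... | no  _ = m≤m+n (suc k) _
  fromClause-target 0<k i (terminal j (z , refl , _)) = ≤-refl

  fromClause-other-end : ∀ {i i'} → i' ≢ i → 2 * k < potential (fromClause i) (pv i' (fromℕ (2 * k)))
  fromClause-other-end {i} {i'} i'≢i with i' Finₚ.≟ i
  ... | yes i'≡i = ⊥-elim (i'≢i i'≡i)
  ... | no  _ rewrite Finₚ.toℕ-fromℕ (2 * k) | ∣2k-k∣≡k =
        s≤s (+-monoʳ-≤ k (≤-reflexive (+-identityʳ k)))

  fromVariable-start : ∀ j e → potential (fromVariable j) (ps j e) ≡ 0
  fromVariable-start j e rewrite dec-true (j Finₚ.≟ j) refl = refl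

  fromVariable-clause-end : ∀ j i → k < potential (fromVariable j) (pv i (fromℕ (2 * k)))
  fromVariable-clause-end j i rewrite Finₚ.toℕ-fromℕ (2 * k) | ∣2k-k∣≡k = ≤-refl

  fromVariable-target : ∀ j {y} → Target y → potential (fromVariable j) y ≤ k → IsTj j y ⊎ Foreign j y
  fromVariable-target j (clause-end i) ≤k = ⊥-elim (<⇒≱ (fromVariable-clause-end j i) ≤k)
  fromVariable-target j (terminal j' (z , refl , z-end)) ≤k with j' Finₚ.≟ j | z-end
  ... | yes refl | _         = inj₁ (z , refl , z-end)
  ... | no  j'≢j | inj₁ z≡0  = inj₂ (j' , z , j'≢j , refl , z≡0)
  ... | no  _    | inj₂ z≡k-1 = ⊥-elim (2+[n∸1]≰n k (subst (λ c → 2 + c ≤ k) z≡k-1 ≤k))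

  module Tracking (S : ReconfSeq) where
    open ReconfSeq S

    -- The token on pos x t moves at step t exactly when its vertex is vacated; this avoids
    -- deciding equality of vertices.
    pos : Vertex → ℕ → Vertex
    leaves : Vertex → ℕ → Bool
    pos x zero    = x
    pos x (suc t) = if leaves x t then to t else pos x t
    leaves x t = not (sets (suc t) (pos x t))

    moves : Vertex → ℕ → ℕ
    moves x zero    = 0
    moves x (suc t) = (if leaves x t then 1 else 0) + moves x t

    pos-stay : ∀ {x t} → sets (suc t) (pos x t) ≡ true → pos x (suc t) ≡ pos x t
    pos-stay {x} {t} = cong (λ b → if not b then to t else pos x t)

    pos-leave : ∀ {x t} → sets (suc t) (pos x t) ≡ false → pos x (suc t) ≡ to t
    pos-leave {x} {t} = cong (λ b → if not b then to t else pos x t)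

    moves-stay : ∀ {x t} → sets (suc t) (pos x t) ≡ true → moves x (suc t) ≡ moves x t
    moves-stay {x} {t} = cong (λ b → (if not b then 1 else 0) + moves x t)

    pos-occupied : ∀ {x t} → I-s x ≡ true → t ≤ len → sets t (pos x t) ≡ true
    pos-occupied {x} {zero}  x∈Iₛ _ = trans (start x) x∈Iₛ
    pos-occupied {x} {suc t} _ t<len with sets (suc t) (pos x t) in occupied
    ... | true  = occupied
    ... | false = proj₂ (to-in t t<len)

    vacated⇒from : ∀ {x t} → I-s x ≡ true → t < len → sets (suc t) (pos x t) ≡ false →
                   pos x t ≡ from t
    vacated⇒from x∈Iₛ t<len = from-uniq _ t<len _ (pos-occupied x∈Iₛ (<⇒≤ t<len))

    occupied⇒≢from : ∀ {y t} → t < len → sets (suc t) y ≡ true → y ≢ from t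
    occupied⇒≢from t<len occupied refl with () ← trans (sym occupied) (proj₂ (from-out _ t<len))

    pos≢to : ∀ {x t} → I-s x ≡ true → t < len → pos x t ≢ to t
    pos≢to x∈Iₛ t<len p≡to with () ←
      trans (sym (pos-occupied x∈Iₛ (<⇒≤ t<len))) (trans (cong (sets _) p≡to) (proj₁ (to-in _ t<len)))

    leaves⇒from : ∀ {x t} → I-s x ≡ true → t < len → leaves x t ≡ true → pos x t ≡ from t
    leaves⇒from {x} {t} x∈Iₛ t<len with sets (suc t) (pos x t) in vacated
    ... | false = λ _ → vacated⇒from x∈Iₛ t<len vacated
    ... | true  = λ ()

    to-neighbour-vacant : ∀ {y t} → t < len → Adj y (to t) → sets (suc t) y ≡ false
    to-neighbour-vacant {y} {t} t<len y~to with sets (suc t) y in occupied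
    ... | false = refl
    ... | true  = ⊥-elim (indep (suc t) t<len y (to t) occupied (proj₂ (to-in t t<len)) y~to)

    pos-injective : ∀ {x x' t} → I-s x ≡ true → I-s x' ≡ true → t ≤ len →
                    pos x t ≡ pos x' t → x ≡ x'
    pos-injective {t = zero} _ _ _ eq = eq
    pos-injective {x} {x'} {suc t} x∈Iₛ x'∈Iₛ t<len eq
      with sets (suc t) (pos x t) in sx | sets (suc t) (pos x' t) in sx'
    ... | true  | true  = pos-injective x∈Iₛ x'∈Iₛ (<⇒≤ t<len) eq
    ... | false | false = pos-injective x∈Iₛ x'∈Iₛ (<⇒≤ t<len)
                            (trans (vacated⇒from x∈Iₛ t<len sx) (sym (vacated⇒from x'∈Iₛ t<len sx')))
    ... | true  | false = ⊥-elim (pos≢to x∈Iₛ t<len eq)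
    ... | false | true  = ⊥-elim (pos≢to x'∈Iₛ t<len (sym eq))

    others-stay : ∀ {x x' t} → I-s x ≡ true → I-s x' ≡ true → t < len →
                  pos x t ≡ from t → x' ≢ x →
                  sets (suc t) (pos x' t) ≡ true
    others-stay {x' = x'} {t} x∈Iₛ x'∈Iₛ t<len p≡from x'≢x with sets (suc t) (pos x' t) in vacated
    ... | true  = refl
    ... | false = ⊥-elim (x'≢x (pos-injective x'∈Iₛ x∈Iₛ (<⇒≤ t<len)
                                 (trans (vacated⇒from x'∈Iₛ t<len vacated) (sym p≡from))))

    pos-surjective : ∀ {y t} → t ≤ len → sets t y ≡ true → ∃[ x ] (I-s x ≡ true × pos x t ≡ y)
    pos-surjective {y} {zero} _ occupied = y , trans (sym (start y)) occupied , refl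
    pos-surjective {y} {suc t} t<len occupied with sets t y in before
    ... | true with pos-surjective (<⇒≤ t<len) before
    ...   | x , x∈Iₛ , p≡y = x , x∈Iₛ , trans (pos-stay (trans (cong (sets (suc t)) p≡y) occupied)) p≡y
    pos-surjective {y} {suc t} t<len occupied | false
      with pos-surjective (<⇒≤ t<len) (proj₁ (from-out t t<len))
    ... | x , x∈Iₛ , p≡from = x , x∈Iₛ ,
          trans (pos-leave (trans (cong (sets (suc t)) p≡from) (proj₂ (from-out t t<len))))
                (sym (to-uniq t t<len y before occupied))

    pos-reach : ∀ {x t} → I-s x ≡ true → t ≤ len → DistLe (moves x t * k) x (pos x t)
    pos-reach {x} {zero}  _ _ = 0 , z≤n , here x
    pos-reach {x} {suc t} x∈Iₛ t<len with sets (suc t) (pos x t) in vacated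
    ... | true  = pos-reach x∈Iₛ (<⇒≤ t<len)
    ... | false = subst (λ d → DistLe d x (to t)) (+-comm (moves x t * k) k)
                    (dist-trans (subst (DistLe _ x) (vacated⇒from x∈Iₛ t<len vacated)
                                       (pos-reach x∈Iₛ (<⇒≤ t<len)))
                                (jump t t<len))

    potential-bound : ∀ {f x} → Lipschitz f → I-s x ≡ true → f (pos x len) ≤ f x + moves x len * k
    potential-bound f-lip x∈Iₛ = lipschitz-dist f-lip (pos-reach x∈Iₛ ≤-refl)

    final-target : ∀ x → I-s x ≡ true → Target (pos x len)
    final-target x x∈Iₛ = target (trans (sym (end _)) (pos-occupied x∈Iₛ ≤-refl))

    moves-mono : ∀ {x t t'} → t ≤′ t' → moves x t ≤ moves x t'
    moves-mono ≤′-refl      = ≤-refl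
    moves-mono (≤′-step le) = ≤-trans (moves-mono le) (m≤n+m _ _)

    pos-settled : ∀ {x t t'} → t ≤′ t' → moves x t' ≤ moves x t → pos x t' ≡ pos x t
    pos-settled ≤′-refl _ = refl
    pos-settled {x} {t} (≤′-step {t'} le) no-more with sets (suc t') (pos x t') in e
    ... | true  = pos-settled le no-more
    ... | false = ⊥-elim (1+n≰n (≤-trans no-more (moves-mono le)))

    vacated-start⇒moved : ∀ {x t} → I-s x ≡ true → t ≤ len → sets t x ≡ false → 1 ≤ moves x t
    vacated-start⇒moved {x} {t} x∈Iₛ t≤len vacant with moves x t in m
    ... | suc _ = s≤s z≤n
    ... | zero with () ← trans (sym vacant)
                    (trans (cong (sets t) (sym (pos-settled {x} {0} {t} z≤′n (≤-reflexive m))))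
                           (pos-occupied x∈Iₛ t≤len))

    track : ∀ {x t} → I-s x ≡ true → t ≤ len → Track S x t (pos x t) (moves x t)
    track {t = zero}  _ _ = track₀
    track {x} {suc t} x∈Iₛ t<len with sets (suc t) (pos x t) in e
    ... | true  = stay (track x∈Iₛ (<⇒≤ t<len)) (occupied⇒≢from t<len e)
    ... | false = move (track x∈Iₛ (<⇒≤ t<len)) (vacated⇒from x∈Iₛ t<len e)

    track-unique : ∀ {x t y c} → I-s x ≡ true → t ≤ len → Track S x t y c →
                   y ≡ pos x t × c ≡ moves x t
    track-unique _ _ track₀ = refl , refl
    track-unique {x} {suc t} x∈Iₛ t<len (stay tr y≢from)
      with track-unique x∈Iₛ (<⇒≤ t<len) tr
    ... | refl , refl with sets (suc t) (pos x t) in e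
    ...   | true  = refl , refl
    ...   | false = ⊥-elim (y≢from (vacated⇒from x∈Iₛ t<len e))
    track-unique {x} {suc t} x∈Iₛ t<len (move tr y≡from)
      with track-unique x∈Iₛ (<⇒≤ t<len) tr
    ... | refl , refl with sets (suc t) (pos x t) in e
    ...   | false = refl , refl
    ...   | true  = ⊥-elim (occupied⇒≢from t<len e y≡from)

    tokenEnd : ∀ {x} {P : Vertex → ℕ → Set} → I-s x ≡ true → P (pos x len) (moves x len) →
               TokenEnd S x P
    tokenEnd {P = P} x∈Iₛ p = (_ , _ , track x∈Iₛ ≤-refl) , λ y c tr →
      let y≡ , c≡ = track-unique x∈Iₛ ≤-refl tr in subst₂ P (sym y≡) (sym c≡) p

    ∑-moves-≤ : ∀ {N} (tok : Vector Vertex N) → Injective _≡_ _≡_ tok →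
                (∀ p → I-s (tok p) ≡ true) →
                ∀ {t} → t ≤ len → ∑[ p < N ] moves (tok p) t ≤ t
    ∑-moves-≤ {N} tok tok-inj tok∈Iₛ {zero} _ = ≤-reflexive (sum-replicate-zero N)
    ∑-moves-≤ {N} tok tok-inj tok∈Iₛ {suc t} t<len = begin
      ∑[ p < N ] ((if leaves (tok p) t then 1 else 0) + moves (tok p) t)
        ≡⟨ ∑-distrib-+ (λ p → if leaves (tok p) t then 1 else 0) (λ p → moves (tok p) t) ⟩
      ∑[ p < N ] (if leaves (tok p) t then 1 else 0) + ∑[ p < N ] moves (tok p) t
        ≤⟨ +-mono-≤ (∑-indicator-≤1 (λ p → leaves (tok p) t) one-leaves)
                    (∑-moves-≤ tok tok-inj tok∈Iₛ (<⇒≤ t<len)) ⟩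
      suc t ∎
      where
      open ≤-Reasoning
      one-leaves : ∀ {p q} → leaves (tok p) t ≡ true → leaves (tok q) t ≡ true → p ≡ q
      one-leaves lp lq = tok-inj (pos-injective (tok∈Iₛ _) (tok∈Iₛ _) (<⇒≤ t<len)
        (trans (leaves⇒from (tok∈Iₛ _) t<len lp) (sym (leaves⇒from (tok∈Iₛ _) t<len lq))))

  module ShortSequence (S : ReconfSeq) (0<k : 0 < k) (short : ReconfSeq.len S ≤ 2 * (m + n)) where
    open ReconfSeq S
    open Tracking S

    clauseTokens : Vector Vertex m
    clauseTokens i = pv i zero

    s₀Tokens s₁Tokens : Vector Vertex n
    s₀Tokens j = ps j zero
    s₁Tokens j = ps j (suc zero)

    variableTokens : Vector Vertex (n + n)
    variableTokens = s₀Tokens ++ s₁Tokens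

    tokens : Vector Vertex (m + (n + n))
    tokens = clauseTokens ++ variableTokens

    tokens-injective : Injective _≡_ _≡_ tokens
    tokens-injective = ++-injective clauseTokens variableTokens (λ { refl → refl })
      (++-injective s₀Tokens s₁Tokens (λ { refl → refl }) (λ { refl → refl }) (λ _ _ ()))
      clause≢variable
      where
      clause≢variable : ∀ i q → pv i zero ≢ variableTokens q
      clause≢variable i q with splitAt n q
      ... | inj₁ _ = λ ()
      ... | inj₂ _ = λ ()

    tokens-initial : ∀ p → I-s (tokens p) ≡ true
    tokens-initial p with splitAt m p
    ... | inj₁ _ = refl
    ... | inj₂ q with splitAt n q
    ...   | inj₁ _ = refl
    ...   | inj₂ _ = refl

    tokens-surjective : ∀ {x} → Initial x → ∃[ p ] tokens p ≡ x
    tokens-surjective (clause-start i) = i ↑ˡ (n + n) , lookup-++ˡ clauseTokens variableTokens i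
    tokens-surjective (variable-start j zero) = m ↑ʳ (j ↑ˡ n) ,
      trans (lookup-++ʳ clauseTokens variableTokens _) (lookup-++ˡ s₀Tokens s₁Tokens j)
    tokens-surjective (variable-start j (suc zero)) = m ↑ʳ (n ↑ʳ j) ,
      trans (lookup-++ʳ clauseTokens variableTokens _) (lookup-++ʳ s₀Tokens s₁Tokens j)

    requiredMoves : Vertex → ℕ
    requiredMoves (pv _ _) = 2
    requiredMoves _        = 1

    ∑-requiredMoves : ∑[ p < m + (n + n) ] requiredMoves (tokens p) ≡ 2 * (m + n)
    ∑-requiredMoves = begin
      ∑[ p < m + (n + n) ] requiredMoves (tokens p)
        ≡⟨ ∑-++ requiredMoves clauseTokens variableTokens ⟩
      ∑[ i < m ] 2 + ∑[ q < n + n ] requiredMoves (variableTokens q)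
        ≡⟨ cong (∑[ i < m ] 2 +_) (∑-++ requiredMoves s₀Tokens s₁Tokens) ⟩
      ∑[ i < m ] 2 + (∑[ j < n ] 1 + ∑[ j < n ] 1)
        ≡⟨ cong₂ _+_ (∑-const m 2) (cong₂ _+_ (∑-const n 1) (∑-const n 1)) ⟩
      m * 2 + (n * 1 + n * 1)
        ≡⟨ arithmetic m n ⟩
      2 * (m + n) ∎
      where
      open ≡-Reasoning
      arithmetic : ∀ a b → a * 2 + (b * 1 + b * 1) ≡ 2 * (a + b)
      arithmetic = solve-∀

    jump-bound : ∀ {P x} → LipschitzProfile P → I-s x ≡ true → potential P x ≡ 0 →
                 potential P (pos x len) ≤ moves x len * k
    jump-bound P-lip x∈Iₛ P[x]≡0 =
      ≤-trans (potential-bound (potential-lipschitz P-lip) x∈Iₛ) (≤-reflexive (cong (_+ _) P[x]≡0))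

    requiredMoves-≤ : ∀ {x} → I-s x ≡ true → requiredMoves x ≤ moves x len
    requiredMoves-≤ {x} x∈Iₛ with initial {x} x∈Iₛ
    ... | clause-start i = 1+n≤c*n⇒2≤c (≤-trans
            (fromClause-target 0<k i (final-target (pv i zero) refl))
            (jump-bound (fromClause-lipschitz i) refl (fromClause-start i)))
    ... | variable-start j e = vacated-start⇒moved refl ≤-refl (end (ps j e))

    moves-exact : ∀ {x} → I-s x ≡ true → moves x len ≡ requiredMoves x
    moves-exact {x} x∈Iₛ with tokens-surjective (initial {x} x∈Iₛ)
    ... | p , refl = sym (tight p)
      where
      tight : ∀ p → requiredMoves (tokens p) ≡ moves (tokens p) len
      tight = ∑-tight (λ p → requiredMoves-≤ (tokens-initial p)) (begin
        ∑[ p < m + (n + n) ] moves (tokens p) len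
          ≤⟨ ∑-moves-≤ tokens tokens-injective tokens-initial ≤-refl ⟩
        len
          ≤⟨ short ⟩
        2 * (m + n)
          ≡⟨ ∑-requiredMoves ⟨
        ∑[ p < m + (n + n) ] requiredMoves (tokens p) ∎)
        where open ≤-Reasoning

    clause-moves : ∀ i → moves (pv i zero) len ≡ 2
    clause-moves i = moves-exact refl

    variable-moves : ∀ j e → moves (ps j e) len ≡ 1
    variable-moves j e = moves-exact refl

    clause-token-near : ∀ i → potential (fromClause i) (pos (pv i zero) len) ≤ 2 * k
    clause-token-near i = ≤-trans (jump-bound (fromClause-lipschitz i) refl (fromClause-start i))
                                  (≤-reflexive (cong (_* k) (clause-moves i)))

    variable-token-near : ∀ j e → potential (fromVariable j) (pos (ps j e) len) ≤ k
    variable-token-near j e = ≤-trans (jump-bound (fromVariable-lipschitz j) refl (fromVariable-start j e))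
                                      (≤-reflexive (trans (cong (_* k) (variable-moves j e)) (+-identityʳ k)))

    clause-end-token : ∀ {x i} → Initial x → pos x len ≡ pv i (fromℕ (2 * k)) → x ≡ pv i zero
    clause-end-token {i = i} (variable-start j e) p≡end = ⊥-elim (<⇒≱ (fromVariable-clause-end j i)
      (subst (λ y → potential (fromVariable j) y ≤ k) p≡end (variable-token-near j e)))
    clause-end-token {i = i} (clause-start i') p≡end with i' Finₚ.≟ i
    ... | yes refl = refl
    ... | no i'≢i  = ⊥-elim (<⇒≱ (fromClause-other-end (i'≢i ∘ sym))
          (subst (λ y → potential (fromClause i') y ≤ 2 * k) p≡end (clause-token-near i')))

    clause-end-occupied : ∀ i → sets len (pv i (fromℕ (2 * k))) ≡ true
    clause-end-occupied i = trans (end _) (Equivalence.to T-≡ (≡⇒≡ᵇ _ _ (Finₚ.toℕ-fromℕ (2 * k))))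

    clause-final : ∀ i → pos (pv i zero) len ≡ pv i (fromℕ (2 * k))
    clause-final i with pos-surjective ≤-refl (clause-end-occupied i)
    ... | x , x∈Iₛ , p≡end with refl ← clause-end-token (initial {x} x∈Iₛ) p≡end = p≡end

    variable-final-class : ∀ j e → IsTj j (pos (ps j e) len) ⊎ Foreign j (pos (ps j e) len)
    variable-final-class j e = fromVariable-target j (final-target (ps j e) refl) (variable-token-near j e)

    NoForeignBy : ℕ → Set
    NoForeignBy t = ∀ j e → 1 ≤ moves (ps j e) t → ¬ Foreign j (pos (ps j e) t)

    t₀-filled⇒settled : ∀ {t j z} e → t < len → to t ≡ pu j z → toℕ z ≡ 0 →
                        sets (suc t) (pos (ps j e) t) ≡ true →
                        1 ≤ moves (ps j e) t × pos (ps j e) len ≡ pos (ps j e) t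
    t₀-filled⇒settled {t} {j} {z} e t<len to≡t₀ z≡0 stays = moved-before ,
      pos-settled (≤⇒≤′ (<⇒≤ t<len)) (≤-trans (≤-reflexive (variable-moves j e)) moved-before)
      where
      vacant : sets (suc t) (ps j e) ≡ false
      vacant = to-neighbour-vacant t<len (inj₁ (subst (Edge (ps j e)) (sym to≡t₀) (s-t0 j e z z≡0)))
      moved-before : 1 ≤ moves (ps j e) t
      moved-before = subst (1 ≤_) (moves-stay stays) (vacated-start⇒moved refl t<len vacant)

    t₀-filled⇒far-end : ∀ {t j z} e → t < len → NoForeignBy t → to t ≡ pu j z → toℕ z ≡ 0 →
                        sets (suc t) (pos (ps j e) t) ≡ true →
                        ∃[ z' ] (pos (ps j e) len ≡ pu j z' × toℕ z' ≡ k ∸ 1)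
    t₀-filled⇒far-end {t} {j} {z} e t<len no-foreign to≡t₀ z≡0 stays
      with t₀-filled⇒settled e t<len to≡t₀ z≡0 stays | variable-final-class j e
    ... | _ , _ | inj₁ (z' , p≡ , inj₂ z'≡k-1) = z' , p≡ , z'≡k-1
    ... | _ , settled | inj₁ (z' , p≡ , inj₁ z'≡0) = ⊥-elim (pos≢to refl t<len (begin
          pos (ps j e) t    ≡⟨ settled ⟨
          pos (ps j e) len  ≡⟨ p≡ ⟩
          pu j z'           ≡⟨ cong (pu j) (Finₚ.toℕ-injective (trans z'≡0 (sym z≡0))) ⟩
          pu j z            ≡⟨ to≡t₀ ⟨
          to t              ∎))
      where open ≡-Reasoning
    ... | moved , settled | inj₂ foreign = ⊥-elim (no-foreign j e moved (subst (Foreign j) settled foreign))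

    arrival-not-foreign : ∀ {t} → t < len → NoForeignBy t → ∀ j e → pos (ps j e) t ≡ from t →
                          ¬ Foreign j (to t)
    arrival-not-foreign {t} t<len no-foreign j e p≡from (j' , z , j'≢j , to≡t₀ , z≡0) =
      distinct-far-ends (far-end zero) (far-end (suc zero))
      where
      FarEnd : Fin 2 → Set
      FarEnd e' = ∃[ z' ] (pos (ps j' e') len ≡ pu j' z' × toℕ z' ≡ k ∸ 1)
      far-end : ∀ e' → FarEnd e'
      far-end e' = t₀-filled⇒far-end e' t<len no-foreign to≡t₀ z≡0
        (others-stay refl refl t<len p≡from λ { refl → j'≢j refl })
      distinct-far-ends : FarEnd zero → FarEnd (suc zero) → ⊥
      distinct-far-ends (z₀ , p₀ , z₀≡) (z₁ , p₁ , z₁≡) with () ←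
        pos-injective {ps j' zero} {ps j' (suc zero)} refl refl ≤-refl
          (trans p₀ (trans (cong (pu j') (Finₚ.toℕ-injective (trans z₀≡ (sym z₁≡)))) (sym p₁)))

    no-foreign : ∀ {t} → t ≤ len → NoForeignBy t
    no-foreign {zero}  _ _ _ ()
    no-foreign {suc t} t<len j e moved with sets (suc t) (pos (ps j e) t) in vacated
    ... | true  = no-foreign (<⇒≤ t<len) j e moved
    ... | false = arrival-not-foreign t<len (no-foreign (<⇒≤ t<len)) j e (vacated⇒from refl t<len vacated)

    variable-final : ∀ j e → IsTj j (pos (ps j e) len)
    variable-final j e with variable-final-class j e
    ... | inj₁ at-terminal = at-terminal
    ... | inj₂ foreign  = ⊥-elim (no-foreign ≤-refl j e (≤-reflexive (sym (variable-moves j e))) foreign)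

lemma11 : (k m n : ℕ) → 3 ≤ k → (Φ : Formula m n) → IsE3 Φ →
          (S : G.ReconfSeq k m n Φ) → G.Shortest k m n Φ S →
          G.ReconfSeq.len S ≤ 2 * (m + n) →
          -- (S1)
          ((∀ (i : Fin m) → G.TokenEnd k m n Φ S (G.pv i zero) (λ y c → c ≡ 2))
           × (∀ (j : Fin n) (e : Fin 2) → G.TokenEnd k m n Φ S (G.ps j e) (λ y c → c ≡ 1)))
          -- (S2)
          × (∀ (i : Fin m) → G.TokenEnd k m n Φ S (G.pv i zero) (λ y c → y ≡ G.pv i (fromℕ (2 * k))))
          -- (S3)
          × (∀ (j : Fin n) (e : Fin 2) → G.TokenEnd k m n Φ S (G.ps j e) (λ y c → G.IsTj k m n Φ j y))
lemma11 k m n 3≤k Φ _ S _ short =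
  ((λ i → tokenEnd refl (clause-moves i)) , (λ j e → tokenEnd refl (variable-moves j e))) ,
  (λ i → tokenEnd refl (clause-final i)) ,
  (λ j e → tokenEnd refl (variable-final j e))
  where
  open Tracking S
  open ShortSequence S (≤-trans (s≤s z≤n) 3≤k) short
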